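{- Let $(G,A)$ be a simple edge-weighted graph on vertices $v_1,\dots,v_n$, and let $(G_n,A_n)$ be the result of applying the star-clique operation to $v_n$. Then the map $\phi:S_G\to S_{G_n}$, $\phi(g_1,\dots,g_n)=(g_1,\dots,g_{n-1})$, is a well-defined surjective $\mathbb{Z}$-module homomorphism whose kernel is $\mathcal{F}_{n-1}\cup\mathcal{F}_n$.
   Context: An edge-weighted graph $(G,A)$ is a finite loopless graph (multiple edges allowed unless "simple" is stated) with vertices $v_1,\dots,v_n$ and a weight function $A$ from its edges to positive integers. A spline on $(G,A)$ is $(g_1,\dots,g_n)\in\mathbb{Z}^n$ with $g_i\equiv g_j\pmod{A(e)}$ for every edge $e$ joining $v_i$ and $v_j$; $S_G$ denotes the $\mathbb{Z}$-module of splines. Star-clique operation on a vertex $v$ of a simple graph with neighbours $w_1,\dots,w_d$ and edge $vw_k$ of weight $a_k$: delete $v$ and its incident edges and, for each pair $j<k$, add a new edge between $w_j$ and $w_k$ of weight $\gcd(a_j,a_k)$ (possibly creating multiple edges); all other vertices and edges are unchanged. Flow-up classes of $S_G$: for $0\le i<n$, $\mathcal{F}_i$ is the set of splines with $g_1=\cdots=g_i=0$ and $g_{i+1}\neq 0$; $\mathcal{F}_n=\{0\}$. -}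

module Defs where

open import Data.Nat using (ℕ; zero; suc; _<_)
open import Data.Nat.GCD using (gcd)
open import Data.Fin using (Fin; zero; suc; toℕ)
open import Data.Maybe using (Maybe; just; nothing)
import Data.Maybe as Maybe
open import Data.Integer using (ℤ; +_; _-_; _+_; _*_)
open import Data.Integer.Divisibility using (_∣_)
open import Data.List using (List; []; _∷_; _++_; map)
open import Data.List.Membership.Propositional using (_∈_)
open import Data.Product using (_×_; _,_; Σ)
open import Relation.Binary.PropositionalEquality using (_≡_; _≢_)

-- An edge of a (multi)graph on vertex set Fin n (vertex v_{k+1} is 'k : Fin n'),
-- with endpoints src, tgt and weight wt.
record Edge (n : ℕ) : Set where
  constructor edge
  field
    src : Fin n
    tgt : Fin n
    wt  : ℕ
open Edge public

-- Multiple edges are allowed; looplessness and positivity of weights are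
-- separate hypotheses (see IsEdgeWeightedGraph).
WGraph : ℕ → Set
WGraph n = List (Edge n)

IsEdgeWeightedGraph : {n : ℕ} → WGraph n → Set
IsEdgeWeightedGraph G = ∀ e → e ∈ G → (src e ≢ tgt e) × (0 < wt e)

SameEnds : {n : ℕ} → Edge n → Edge n → Set
SameEnds e f = ((src e ≡ src f) × (tgt e ≡ tgt f)) Data.Sum.⊎ ((src e ≡ tgt f) × (tgt e ≡ src f))
  where import Data.Sum

-- simple: no two distinct edge occurrences in the list join the same pair.
-- (Edges are list entries; two entries at different positions are different edges.)
IsSimple : {n : ℕ} → WGraph n → Set
IsSimple G = Data.List.Relation.Unary.AllPairs.AllPairs (λ e f → SameEnds e f → Data.Empty.⊥) G
  where import Data.List.Relation.Unary.AllPairs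
        import Data.Empty

IsSpline : {n : ℕ} → WGraph n → (Fin n → ℤ) → Set
IsSpline G g = ∀ e → e ∈ G → (+ wt e) ∣ (g (src e) - g (tgt e))

-- Flow-up class F_i (0 ≤ i ≤ n): splines with g_1 = … = g_i = 0 and g_{i+1} ≠ 0;
-- for i = n the last condition is absent, so F_n = {0}.
FlowUp : {n : ℕ} → WGraph n → ℕ → (Fin n → ℤ) → Set
FlowUp {n} G i g =
  IsSpline G g × (∀ j → toℕ j < i → g j ≡ + 0)
    × (i < n → ∀ j → toℕ j ≡ i → g j ≢ + 0)

strip : {n : ℕ} → Fin (suc n) → Maybe (Fin n)
strip {zero}  zero    = nothing
strip {suc n} zero    = just zero
strip {suc n} (suc i) = Maybe.map suc (strip i)

neighbours : {n : ℕ} → WGraph (suc n) → List (Fin n × ℕ)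
neighbours [] = []
neighbours (e ∷ es) with strip (src e) | strip (tgt e)
... | nothing | just w  = (w , wt e) ∷ neighbours es
... | just w  | nothing = (w , wt e) ∷ neighbours es
... | _       | _       = neighbours es

keptEdges : {n : ℕ} → WGraph (suc n) → WGraph n
keptEdges [] = []
keptEdges (e ∷ es) with strip (src e) | strip (tgt e)
... | just u | just v = edge u v (wt e) ∷ keptEdges es
... | _      | _      = keptEdges es

cliqueEdges : {n : ℕ} → List (Fin n × ℕ) → WGraph n
cliqueEdges [] = []
cliqueEdges ((w , a) ∷ rest) =
  map (λ { (w' , b) → edge w w' (gcd a b) }) rest ++ cliqueEdges rest

starCliqueLast : {n : ℕ} → WGraph (suc n) → WGraph n
starCliqueLast G = keptEdges G ++ cliqueEdges (neighbours G)

φ : {n : ℕ} → (Fin (suc n) → ℤ) → (Fin n → ℤ)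
φ g i = g (Data.Fin.inject₁ i)

-- If g is a spline on G, then gcd(a_j, a_k) divides g_n − g(w_j) and g_n − g(w_k), hence their
-- difference, so φ g also satisfies the new clique edges. Conversely, a spline h on G_n makes the
-- congruences x ≡ h(w_k) (mod a_k) pairwise compatible, the clique edge w_j w_k saying exactly
-- gcd(a_j, a_k) ∣ h(w_j) − h(w_k); the Chinese remainder theorem for non-coprime moduli gives a common
-- solution x, and h extended by g_n = x is a spline on G. That theorem is proved by induction, keeping
-- a solution modulo the lcm M of the moduli so far: adding x ≡ r (mod c) needs gcd(c, M) ∣ x − r, which
-- comes from gcd(c, lcm(u, v)) ∣ lcm(gcd(c, u), gcd(c, v)) and Bézout's identity.
-- A spline with g_1 = … = g_{n−1} = 0 lies in F_{n−1} or F_n according as g_n ≠ 0 or g_n = 0.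

module Submission where

open import Data.Nat as ℕ using (ℕ; zero; suc; _<_; _≤_)
open import Data.Nat.GCD
open import Data.Nat.LCM using (lcm; lcm-least; m∣lcm[m,n]; n∣lcm[m,n]; gcd*lcm; lcm[0,n]≡0)
open import Data.Nat.Properties using (*-comm; <-irrefl; <-≤-trans; ≤-refl; n≤1+n)
open import Data.Integer as ℤ using (ℤ; +_; 0ℤ; -_; _+_; _-_; _*_)
open import Data.Integer.Properties
  using (pos-+; pos-*; +-comm; +-inverseʳ; neg-distribˡ-*; +-minus-telescope)
open import Data.Integer.Tactic.RingSolver using (solve-∀)
open import Data.Fin using (Fin; toℕ; inject₁; fromℕ)
open import Data.Fin.Properties using (toℕ-injective; toℕ<n; toℕ-fromℕ; toℕ-inject₁)
open import Data.Maybe using (just; nothing; maybe′)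
open import Data.List using (List; []; _∷_; map; foldr)
open import Data.List.Relation.Unary.All as All using (All; []; _∷_)
open import Data.List.Relation.Unary.All.Properties using (++⁺; ++⁻ˡ; ++⁻ʳ; map⁺; map⁻)
open import Data.List.Relation.Unary.AllPairs using (AllPairs; []; _∷_)
open import Data.Product using (Σ; ∃; ∃₂; _×_; _,_; proj₁; proj₂; uncurry)
open import Data.Sum using (_⊎_; inj₁; inj₂)
open import Data.Empty using (⊥-elim)
open import Relation.Nullary using (yes; no)
open import Function using (_∘_)
open import Relation.Binary.PropositionalEquality
open import Defs

module _ where
  open import Data.Nat.Divisibility
    using (_∣_; ∣-trans; *-pres-∣; *-cancelˡ-∣; _∣0; 1∣_)

  ∣gcd*gcd : ∀ {m} a b c d → m ∣ a ℕ.* c → m ∣ a ℕ.* d → m ∣ b ℕ.* c → m ∣ b ℕ.* d →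
             m ∣ gcd a b ℕ.* gcd c d
  ∣gcd*gcd {m} a b c d m∣ac m∣ad m∣bc m∣bd =
    subst (m ∣_) products≡ (gcd-greatest (gcd-greatest m∣ac m∣ad) (gcd-greatest m∣bc m∣bd))
    where
    open ≡-Reasoning
    products≡ : gcd (gcd (a ℕ.* c) (a ℕ.* d)) (gcd (b ℕ.* c) (b ℕ.* d)) ≡ gcd a b ℕ.* gcd c d
    products≡ = begin
      gcd (gcd (a ℕ.* c) (a ℕ.* d)) (gcd (b ℕ.* c) (b ℕ.* d))
        ≡⟨ sym (cong₂ gcd (c*gcd[m,n]≡gcd[cm,cn] a c d) (c*gcd[m,n]≡gcd[cm,cn] b c d)) ⟩
      gcd (a ℕ.* gcd c d) (b ℕ.* gcd c d)
        ≡⟨ cong₂ gcd (*-comm a (gcd c d)) (*-comm b (gcd c d)) ⟩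
      gcd (gcd c d ℕ.* a) (gcd c d ℕ.* b)
        ≡⟨ sym (c*gcd[m,n]≡gcd[cm,cn] (gcd c d) a b) ⟩
      gcd c d ℕ.* gcd a b
        ≡⟨ *-comm (gcd c d) (gcd a b) ⟩
      gcd a b ℕ.* gcd c d ∎

  gcd[c,lcm[u,v]]∣lcm[gcd[c,u],gcd[c,v]] :
    ∀ c u v → gcd c (lcm u v) ∣ lcm (gcd c u) (gcd c v)
  gcd[c,lcm[u,v]]∣lcm[gcd[c,u],gcd[c,v]] c u v with gcd (gcd c u) (gcd c v) in k≡
  ... | zero = subst (gcd c (lcm u v) ∣_) l≡0 (_ ∣0)
    where
    l≡0 : 0 ≡ lcm (gcd c u) (gcd c v)
    l≡0 = sym (trans (cong (λ g → lcm g (gcd c v)) (gcd[m,n]≡0⇒m≡0 {gcd c u} {gcd c v} k≡))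
                     (lcm[0,n]≡0 (gcd c v)))
  ... | k@(suc _) = *-cancelˡ-∣ k (subst (k ℕ.* d ∣_) g₁g₂≡kl k*d∣g₁*g₂)
    where
    d = gcd c (lcm u v)
    d∣c = gcd[m,n]∣m c (lcm u v)
    d∣L = gcd[m,n]∣n c (lcm u v)
    k∣g₁ = subst (_∣ gcd c u) k≡ (gcd[m,n]∣m (gcd c u) (gcd c v))
    k∣g₂ = subst (_∣ gcd c v) k≡ (gcd[m,n]∣n (gcd c u) (gcd c v))
    k∣c = ∣-trans k∣g₁ (gcd[m,n]∣m c u)
    k∣u = ∣-trans k∣g₁ (gcd[m,n]∣n c u)
    k∣v = ∣-trans k∣g₂ (gcd[m,n]∣n c v)
    k*d∣g₁*g₂ : k ℕ.* d ∣ gcd c u ℕ.* gcd c v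
    k*d∣g₁*g₂ = ∣gcd*gcd c u c v
      (*-pres-∣ k∣c d∣c)
      (subst (k ℕ.* d ∣_) (*-comm v c) (*-pres-∣ k∣v d∣c))
      (*-pres-∣ k∣u d∣c)
      (subst (k ℕ.* d ∣_) (gcd*lcm u v) (*-pres-∣ (gcd-greatest k∣u k∣v) d∣L))
    g₁g₂≡kl : gcd c u ℕ.* gcd c v ≡ k ℕ.* lcm (gcd c u) (gcd c v)
    g₁g₂≡kl = trans (sym (gcd*lcm (gcd c u) (gcd c v))) (cong (ℕ._* lcm (gcd c u) (gcd c v)) k≡)

  lcms : List ℕ → ℕ
  lcms = foldr lcm 1

  ∣lcms : ∀ as → All (_∣ lcms as) as
  ∣lcms [] = []
  ∣lcms (a ∷ as) =
    m∣lcm[m,n] a (lcms as) ∷ All.map (λ a′∣ → ∣-trans a′∣ (n∣lcm[m,n] a (lcms as))) (∣lcms as)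

  gcd[c,lcms]∣ : ∀ c {y} as → All (λ a → gcd c a ∣ y) as → gcd c (lcms as) ∣ y
  gcd[c,lcms]∣ c {y} [] [] = subst (_∣ y) (sym (gcd-zeroʳ c)) (1∣ y)
  gcd[c,lcms]∣ c (a ∷ as) (gcd∣y ∷ gcds∣y) =
    ∣-trans (gcd[c,lcm[u,v]]∣lcm[gcd[c,u],gcd[c,v]] c a (lcms as))
            (lcm-least gcd∣y (gcd[c,lcms]∣ c as gcds∣y))

open import Data.Integer.Divisibility.Signed

m+n≡o⇒+m≡+o-+n : ∀ {m n o} → m ℕ.+ n ≡ o → + m ≡ + o - + n
m+n≡o⇒+m≡+o-+n {m} {n} refl = begin
  + m                   ≡⟨ add-sub (+ m) (+ n) ⟩
  (+ m + + n) - + n     ≡⟨ cong (_- + n) (sym (pos-+ m n)) ⟩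
  + (m ℕ.+ n) - + n     ∎
  where
  open ≡-Reasoning
  add-sub : ∀ i j → i ≡ (i + j) - j
  add-sub = solve-∀

bézout : ∀ m n → ∃₂ λ x y → + gcd m n ≡ x * + m + y * + n
bézout m n with Bézout.identity (gcd-GCD m n)
... | Bézout.+- x y eq = + x , - + y , (begin
  + gcd m n                     ≡⟨ m+n≡o⇒+m≡+o-+n eq ⟩
  + (x ℕ.* m) - + (y ℕ.* n)     ≡⟨ cong₂ _-_ (pos-* x m) (pos-* y n) ⟩
  (+ x * + m) - (+ y * + n)     ≡⟨ cong (λ t → (+ x * + m) + t) (neg-distribˡ-* (+ y) (+ n)) ⟩
  (+ x * + m) + (- + y * + n)   ∎)
  where open ≡-Reasoning
... | Bézout.-+ x y eq = - + x , + y , (begin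
  + gcd m n                     ≡⟨ m+n≡o⇒+m≡+o-+n eq ⟩
  + (y ℕ.* n) - + (x ℕ.* m)     ≡⟨ cong₂ _-_ (pos-* y n) (pos-* x m) ⟩
  (+ y * + n) - (+ x * + m)     ≡⟨ +-comm (+ y * + n) _ ⟩
  - (+ x * + m) + (+ y * + n)   ≡⟨ cong (_+ (+ y * + n)) (neg-distribˡ-* (+ x) (+ m)) ⟩
  (- + x * + m) + (+ y * + n)   ∎)
  where open ≡-Reasoning

-- a ≡ b (mod k) is written k ∣ a - b with signed divisibility; IsSpline uses the unsigned one,
-- hence the conversions ∣ᵤ⇒∣ and ∣⇒∣ᵤ.
module _ {k : ℤ} where

  ∣-sub-cong : ∀ {a a′ b b′} → a ≡ a′ → b ≡ b′ → k ∣ a - b → k ∣ a′ - b′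
  ∣-sub-cong refl refl k∣a-b = k∣a-b

  ∣-sub-refl : ∀ a → k ∣ a - a
  ∣-sub-refl a = divides 0ℤ (+-inverseʳ a)

  ∣-sub-sym : ∀ {a b} → k ∣ a - b → k ∣ b - a
  ∣-sub-sym {a} {b} k∣a-b = subst (k ∣_) (neg-sub a b) (∣m⇒∣-m k∣a-b)
    where
    neg-sub : ∀ a b → - (a - b) ≡ b - a
    neg-sub = solve-∀

  ∣-sub-trans : ∀ {a b c} → k ∣ a - b → k ∣ b - c → k ∣ a - c
  ∣-sub-trans {a} {b} {c} k∣a-b k∣b-c =
    subst (k ∣_) (+-minus-telescope a b c) (∣m∣n⇒∣m+n k∣a-b k∣b-c)

  ∣-sub-shift : ∀ {a b} c → k ∣ a - b → k ∣ c → k ∣ (a + c) - b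
  ∣-sub-shift {a} {b} c k∣a-b k∣c = subst (k ∣_) (shift a b c) (∣m∣n⇒∣m+n k∣a-b k∣c)
    where
    shift : ∀ a b c → (a - b) + c ≡ (a + c) - b
    shift = solve-∀

gcd-congruence⇒shift : ∀ c M x r → + gcd c M ∣ x - r → ∃ λ z → + c ∣ (x + z * + M) - r
gcd-congruence⇒shift c M x r (divides q x-r≡q*gcd) with bézout c M
... | u , v , gcd≡ = - (q * v) , divides (q * u) (begin
  (x + - (q * v) * + M) - r                 ≡⟨ regroup x r (q * v) (+ M) ⟩
  (x - r) - q * v * + M                     ≡⟨ cong (λ t → t - q * v * + M) x-r≡q*gcd ⟩
  q * + gcd c M - q * v * + M               ≡⟨ cong (λ g → q * g - q * v * + M) gcd≡ ⟩
  q * (u * + c + v * + M) - q * v * + M     ≡⟨ cancel q u (+ c) v (+ M) ⟩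
  q * u * + c                               ∎)
  where
  open ≡-Reasoning
  regroup : ∀ x r s m → (x + - s * m) - r ≡ (x - r) - s * m
  regroup = solve-∀
  cancel : ∀ q u c v m → q * (u * c + v * m) - q * v * m ≡ q * u * c
  cancel = solve-∀

Solves : ℤ → ℕ × ℤ → Set
Solves x (a , r) = + a ∣ x - r

Compatible : ℕ × ℤ → ℕ × ℤ → Set
Compatible (a , r) (b , s) = + gcd a b ∣ r - s

compatible⇒gcd∣ : ∀ c r sys x → All (Compatible (c , r)) sys → All (Solves x) sys →
                  + gcd c (lcms (map proj₁ sys)) ∣ x - r
compatible⇒gcd∣ c r sys x compat sols =
  ∣ᵤ⇒∣ (gcd[c,lcms]∣ c (map proj₁ sys)
          (map⁺ (All.zipWith (λ (p , q) → ∣⇒∣ᵤ (gcd∣x-r p q)) (compat , sols))))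
  where
  gcd∣x-r : ∀ {p} → Compatible (c , r) p → Solves x p → + gcd c (proj₁ p) ∣ x - r
  gcd∣x-r {a , s} gcd∣r-s a∣x-s =
    ∣-sub-trans {a = x} {b = s} (∣-trans (∣ᵤ⇒∣ (gcd[m,n]∣n c a)) a∣x-s)
                                (∣-sub-sym {a = r} gcd∣r-s)

solution-extends : ∀ c r sys x → + gcd c (lcms (map proj₁ sys)) ∣ x - r → All (Solves x) sys →
                   ∃ λ x′ → All (Solves x′) ((c , r) ∷ sys)
solution-extends c r sys x gcd∣x-r sols =
  let z , c∣ = gcd-congruence⇒shift c M x r gcd∣x-r
  in x + z * + M
   , c∣ ∷ All.zipWith (λ (a∣x-s , a∣M) → ∣-sub-shift {a = x} (z * + M) a∣x-s (∣n⇒∣m*n z (∣ᵤ⇒∣ {i = + M} a∣M)))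
                      (sols , map⁻ (∣lcms (map proj₁ sys)))
  where
  M = lcms (map proj₁ sys)

chinese-remainder : ∀ sys → AllPairs Compatible sys → ∃ λ x → All (Solves x) sys
chinese-remainder [] [] = 0ℤ , []
chinese-remainder ((c , r) ∷ sys) (compat ∷ compats) =
  let x , sols = chinese-remainder sys compats
  in solution-extends c r sys x (compatible⇒gcd∣ c r sys x compat sols) sols

strip-inject₁ : ∀ {n} (i : Fin n) → strip (inject₁ i) ≡ just i
strip-inject₁ {suc n} Fin.zero = refl
strip-inject₁ {suc n} (Fin.suc i) rewrite strip-inject₁ i = refl

strip≡just⇒ : ∀ {n} {j : Fin (suc n)} {i} → strip j ≡ just i → j ≡ inject₁ i
strip≡just⇒ {suc n} {Fin.zero} refl = refl
strip≡just⇒ {suc n} {Fin.suc j} eq with strip j in s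
strip≡just⇒ {suc n} {Fin.suc j} refl | just i = cong Fin.suc (strip≡just⇒ s)

strip≡nothing⇒ : ∀ {n} {j : Fin (suc n)} → strip j ≡ nothing → j ≡ fromℕ n
strip≡nothing⇒ {zero} {Fin.zero} refl = refl
strip≡nothing⇒ {suc n} {Fin.suc j} eq with strip j in s
strip≡nothing⇒ {suc n} {Fin.suc j} refl | nothing = cong Fin.suc (strip≡nothing⇒ s)

module _ {n : ℕ} where

  Agrees : (Fin n → ℤ) → Edge n → Set
  Agrees g e = + wt e ∣ g (src e) - g (tgt e)

  spline⇒agrees : ∀ {G} g → IsSpline G g → All (Agrees g) G
  spline⇒agrees g sp = All.tabulate λ {e} e∈G → ∣ᵤ⇒∣ (sp e e∈G)

  agrees⇒spline : ∀ {G} g → All (Agrees g) G → IsSpline G g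
  agrees⇒spline g agr e e∈G = ∣⇒∣ᵤ (All.lookup agr e∈G)

  residues : (Fin n → ℤ) → List (Fin n × ℕ) → List (ℕ × ℤ)
  residues h = map (λ (w , a) → a , h w)

  clique-agrees : ∀ h x L → All (Solves x) (residues h L) → All (Agrees h) (cliqueEdges L)
  clique-agrees h x [] [] = []
  clique-agrees h x ((w , a) ∷ L) (a∣x-hw ∷ sols) =
    ++⁺ (map⁺ (All.map gcd∣hw-hw′ (map⁻ sols))) (clique-agrees h x L sols)
    where
    gcd∣hw-hw′ : ∀ {p} → Solves x (proj₂ p , h (proj₁ p)) →
                 + gcd a (proj₂ p) ∣ h w - h (proj₁ p)
    gcd∣hw-hw′ {w′ , b} b∣x-hw′ = ∣-sub-trans {a = h w} {b = x}
      (∣-trans (∣ᵤ⇒∣ (gcd[m,n]∣m a b)) (∣-sub-sym {a = x} a∣x-hw))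
      (∣-trans (∣ᵤ⇒∣ (gcd[m,n]∣n a b)) b∣x-hw′)

  clique-compatible : ∀ h L → All (Agrees h) (cliqueEdges L) → AllPairs Compatible (residues h L)
  clique-compatible h [] _ = []
  clique-compatible h ((w , a) ∷ L) agr =
    map⁺ (map⁻ (++⁻ˡ _ agr)) ∷ clique-compatible h L (++⁻ʳ _ agr)

module _ {n : ℕ} where

  kept-agrees : ∀ (g : Fin (suc n) → ℤ) G → All (Agrees g) G → All (Agrees (φ g)) (keptEdges G)
  kept-agrees g [] [] = []
  kept-agrees g (e ∷ G) (e-agrees ∷ G-agrees) with strip (src e) in s | strip (tgt e) in t
  ... | just u  | just v  =
    ∣-sub-cong (cong g (strip≡just⇒ s)) (cong g (strip≡just⇒ t)) e-agrees
    ∷ kept-agrees g G G-agrees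
  ... | just _  | nothing = kept-agrees g G G-agrees
  ... | nothing | _       = kept-agrees g G G-agrees

  neighbours-solved : ∀ (g : Fin (suc n) → ℤ) G → All (Agrees g) G →
                      All (Solves (g (fromℕ n))) (residues (φ g) (neighbours G))
  neighbours-solved g [] [] = []
  neighbours-solved g (e ∷ G) (e-agrees ∷ G-agrees) with strip (src e) in s | strip (tgt e) in t
  ... | nothing | just w  =
    ∣-sub-cong (cong g (strip≡nothing⇒ s)) (cong g (strip≡just⇒ t)) e-agrees
    ∷ neighbours-solved g G G-agrees
  ... | just w  | nothing =
    ∣-sub-sym {a = g (inject₁ w)} (∣-sub-cong (cong g (strip≡just⇒ s)) (cong g (strip≡nothing⇒ t)) e-agrees)
    ∷ neighbours-solved g G G-agrees
  ... | just _  | just _  = neighbours-solved g G G-agrees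
  ... | nothing | nothing = neighbours-solved g G G-agrees

  extendLast : ℤ → (Fin n → ℤ) → Fin (suc n) → ℤ
  extendLast x h j = maybe′ h x (strip j)

  φ-extendLast : ∀ x h i → φ (extendLast x h) i ≡ h i
  φ-extendLast x h i = cong (maybe′ h x) (strip-inject₁ i)

  agrees-extendLast : ∀ {x h} e {i j} → strip (src e) ≡ i → strip (tgt e) ≡ j →
                      + wt e ∣ maybe′ h x i - maybe′ h x j → Agrees (extendLast x h) e
  agrees-extendLast e refl refl e-agrees = e-agrees

  extendLast-agrees : ∀ x h G → All (Agrees h) (keptEdges G) →
                      All (Solves x) (residues h (neighbours G)) → All (Agrees (extendLast x h)) G
  extendLast-agrees x h [] _ _ = []
  extendLast-agrees x h (e ∷ G) kept sols with strip (src e) in s | strip (tgt e) in t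
  ... | just u  | just v  =
    agrees-extendLast e s t (All.head kept) ∷ extendLast-agrees x h G (All.tail kept) sols
  ... | nothing | just w  =
    agrees-extendLast e s t (All.head sols) ∷ extendLast-agrees x h G kept (All.tail sols)
  ... | just w  | nothing =
    agrees-extendLast e s t (∣-sub-sym {a = x} (All.head sols)) ∷ extendLast-agrees x h G kept (All.tail sols)
  ... | nothing | nothing =
    agrees-extendLast e s t (∣-sub-refl x) ∷ extendLast-agrees x h G kept sols

  φ-spline : ∀ G g → IsSpline G g → IsSpline (starCliqueLast G) (φ g)
  φ-spline G g sp = agrees⇒spline (φ g) (++⁺
    (kept-agrees g G agr)
    (clique-agrees (φ g) (g (fromℕ n)) (neighbours G) (neighbours-solved g G agr)))
    where
    agr = spline⇒agrees g sp

  φ-surjective : ∀ G h → IsSpline (starCliqueLast G) h →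
                 Σ (Fin (suc n) → ℤ) λ g → IsSpline G g × (∀ i → φ g i ≡ h i)
  φ-surjective G h sp =
    let x , sols = chinese-remainder (residues h (neighbours G))
                     (clique-compatible h (neighbours G) (++⁻ʳ (keptEdges G) agr))
    in extendLast x h
     , agrees⇒spline (extendLast x h) (extendLast-agrees x h G (++⁻ˡ (keptEdges G) agr) sols)
     , φ-extendLast x h
    where
    agr = spline⇒agrees h sp

  φ≗0⇒below-last≡0 : ∀ {g : Fin (suc n) → ℤ} → (∀ i → φ g i ≡ 0ℤ) →
                     ∀ j → toℕ j < n → g j ≡ 0ℤ
  φ≗0⇒below-last≡0 {g} φg≗0 j j<n with strip j in s
  ... | just i  = trans (cong g (strip≡just⇒ s)) (φg≗0 i)
  ... | nothing = ⊥-elim (<-irrefl (trans (cong toℕ (strip≡nothing⇒ s)) (toℕ-fromℕ n)) j<n)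

  φ≗0⇒≗0 : ∀ {g : Fin (suc n) → ℤ} → g (fromℕ n) ≡ 0ℤ → (∀ i → φ g i ≡ 0ℤ) →
           ∀ j → g j ≡ 0ℤ
  φ≗0⇒≗0 {g} g-last≡0 φg≗0 j with strip j in s
  ... | just i  = trans (cong g (strip≡just⇒ s)) (φg≗0 i)
  ... | nothing = trans (cong g (strip≡nothing⇒ s)) g-last≡0

  below≡0⇒φ≗0 : ∀ {g : Fin (suc n) → ℤ} {m} → n ≤ m → (∀ j → toℕ j < m → g j ≡ 0ℤ) →
                ∀ i → φ g i ≡ 0ℤ
  below≡0⇒φ≗0 n≤m below≡0 i =
    below≡0 (inject₁ i) (<-≤-trans (subst (_< n) (sym (toℕ-inject₁ i)) (toℕ<n i)) n≤m)

  φ-kernel⇒FlowUp : ∀ G (g : Fin (suc n) → ℤ) → IsSpline G g → (∀ i → φ g i ≡ 0ℤ) →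
                     FlowUp G n g ⊎ FlowUp G (suc n) g
  φ-kernel⇒FlowUp G g sp φg≗0 with g (fromℕ n) ℤ.≟ 0ℤ
  ... | yes g-last≡0 =
    inj₂ (sp , (λ j _ → φ≗0⇒≗0 g-last≡0 φg≗0 j) , λ n<n → ⊥-elim (<-irrefl refl n<n))
  ... | no g-last≢0  =
    inj₁ (sp , φ≗0⇒below-last≡0 φg≗0 , λ _ j toℕj≡n → g-last≢0 ∘ trans (cong g (sym (j≡last toℕj≡n))))
    where
    j≡last : ∀ {j} → toℕ j ≡ n → j ≡ fromℕ n
    j≡last toℕj≡n = toℕ-injective (trans toℕj≡n (sym (toℕ-fromℕ n)))

  FlowUp⇒φ-kernel : ∀ G (g : Fin (suc n) → ℤ) → FlowUp G n g ⊎ FlowUp G (suc n) g →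
                     IsSpline G g × (∀ i → φ g i ≡ 0ℤ)
  FlowUp⇒φ-kernel G g (inj₁ (sp , below≡0 , _)) = sp , below≡0⇒φ≗0 ≤-refl below≡0
  FlowUp⇒φ-kernel G g (inj₂ (sp , below≡0 , _)) = sp , below≡0⇒φ≗0 (n≤1+n n) below≡0

theorem3p6 : (n : ℕ) (G : WGraph (suc n)) → IsEdgeWeightedGraph G → IsSimple G →
    ((g : Fin (suc n) → ℤ) → IsSpline G g → IsSpline (starCliqueLast G) (φ g))
    × ((g h : Fin (suc n) → ℤ) → ∀ i → φ (λ j → g j + h j) i ≡ φ g i + φ h i)
    × ((c : ℤ) (g : Fin (suc n) → ℤ) → ∀ i → φ (λ j → c * g j) i ≡ c * φ g i)
    × ((h : Fin n → ℤ) → IsSpline (starCliqueLast G) h →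
         Σ (Fin (suc n) → ℤ) (λ g → IsSpline G g × (∀ i → φ g i ≡ h i)))
    × ((g : Fin (suc n) → ℤ) →
         ((IsSpline G g × (∀ i → φ g i ≡ + 0)) → (FlowUp G n g ⊎ FlowUp G (suc n) g))
         × ((FlowUp G n g ⊎ FlowUp G (suc n) g) → (IsSpline G g × (∀ i → φ g i ≡ + 0))))
theorem3p6 n G _ _ =
    φ-spline G
  , (λ _ _ _ → refl)
  , (λ _ _ _ → refl)
  , φ-surjective G
  , λ g → uncurry (φ-kernel⇒FlowUp G g) , FlowUp⇒φ-kernel G g
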